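{- Let $k\ge r\ge 1$ be integers. Then $\mathcal{P}_{k,r}$ and $\mathcal{D}_{k,r}$ are separable integer partition classes with modulus $k$. Here $\mathcal{P}_{k,r}$ is the set of partitions $(\pi_1,\dots,\pi_\ell)$ such that each $\pi_i$ is congruent modulo $k$ to some (unique) $\varphi_{k,r}(\pi_i)\in\{1,\dots,r\}$ and $\varphi_{k,r}(\pi_i)\ge\varphi_{k,r}(\pi_{i+1})$ for $1\le i<\ell$; and $\mathcal{D}_{k,r}$ is the set of partitions in $\mathcal{P}_{k,r}$ satisfying in addition $\pi_i-\pi_{i+1}\ge k$ for $1\le i<\ell$.
   Context: A partition is a finite non-increasing sequence of positive integers. For a positive integer $k$, a set $\mathcal{P}$ of partitions is a separable integer partition class with modulus $k$ if there is a subset $\mathcal{B}\subset\mathcal{P}$ (the basis) such that for each integer $m\ge1$ the number of partitions in $\mathcal{B}$ with $m$ parts is finite, every partition in $\mathcal{P}$ with $m$ parts is uniquely of the form $(b_1+\pi_1,b_2+\pi_2,\dots,b_m+\pi_m)$ where $(b_1,\dots,b_m)\in\mathcal{B}$ and $(\pi_1,\dots,\pi_m)$ is a non-increasing sequence of nonnegative integers each divisible by $k$, and all partitions of this form lie in $\mathcal{P}$. -}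

module Defs where

open import Data.Nat using (ℕ; zero; suc; _+_; _*_; _∸_; _≤_; _<_; _%_; NonZero)
open import Data.Nat.Divisibility using (_∣_)
open import Data.List using (List; []; _∷_; length; zipWith)
open import Data.List.Membership.Propositional using (_∈_)
open import Data.Product using (Σ; ∃; _×_; _,_)
open import Relation.Binary.PropositionalEquality using (_≡_)
open import Data.Unit using (⊤)

Consec : (ℕ → ℕ → Set) → List ℕ → Set
Consec R []            = ⊤
Consec R (x ∷ [])      = ⊤
Consec R (x ∷ y ∷ xs)  = R x y × Consec R (y ∷ xs)

Each : (ℕ → Set) → List ℕ → Set
Each Q []       = ⊤
Each Q (x ∷ xs) = Q x × Each Q xs

IsPartition : List ℕ → Set
IsPartition π = Each (λ x → 1 ≤ x) π × Consec (λ x y → y ≤ x) π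

PartitionSet : Set₁
PartitionSet = List ℕ → Set

IsKSeq : ℕ → List ℕ → Set
IsKSeq k μ = Each (λ x → k ∣ x) μ × Consec (λ x y → y ≤ x) μ

record IsSIPC (k : ℕ) (P : PartitionSet) : Set₁ where
  field
    allPartitions : ∀ π → P π → IsPartition π
    basis         : PartitionSet
    basis⊆        : ∀ b → basis b → P b
    basisFinite   : ∀ (m : ℕ) → 1 ≤ m →
                      Σ (List (List ℕ)) λ L →
                        ∀ b → basis b → length b ≡ m → b ∈ L
    decomp        : ∀ π → P π → 1 ≤ length π →
                      Σ (List ℕ) λ b → Σ (List ℕ) λ μ →
                        basis b × length b ≡ length π × length μ ≡ length π ×
                        IsKSeq k μ × π ≡ zipWith _+_ b μ
    decompUnique  : ∀ (b b′ μ μ′ : List ℕ) →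
                      basis b → basis b′ →
                      length μ ≡ length b → length b′ ≡ length b → length μ′ ≡ length b →
                      IsKSeq k μ → IsKSeq k μ′ →
                      zipWith _+_ b μ ≡ zipWith _+_ b′ μ′ →
                      b ≡ b′ × μ ≡ μ′
    closed        : ∀ (b μ : List ℕ) → basis b → 1 ≤ length b → length μ ≡ length b →
                      IsKSeq k μ → P (zipWith _+_ b μ)

φ : (k : ℕ) → .{{NonZero k}} → ℕ → ℕ
φ k x with x % k
... | zero  = k
... | suc j = suc j

Pkr : (k r : ℕ) → .{{NonZero k}} → PartitionSet
Pkr k r π = IsPartition π ×
            Each (λ x → φ k x ≤ r) π ×
            Consec (λ x y → φ k y ≤ φ k x) π

Dkr : (k r : ℕ) → .{{NonZero k}} → PartitionSet
Dkr k r π = Pkr k r π × Consec (λ x y → y + k ≤ x) π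

{-# OPTIONS --safe #-}
module Submission where

-- Every x ≥ 1 is uniquely φ(x) + q(x)k with 1 ≤ φ(x) ≤ k, and q is monotone. Membership in 𝒫_{k,r}
-- constrains only the order of the parts and their residues φ, so 𝒫_{k,r} is separable with basis
-- the partitions with parts in {1, …, r}: π = (φ(πᵢ))ᵢ + (q(πᵢ)k)ᵢ, and r ≤ k lets φ recover the basis
-- part from any sum. Subtracting the staircase ((ℓ−1)k, …, k, 0) maps the members of 𝒟_{k,r} with ℓ
-- parts bijectively onto those of 𝒫_{k,r}: it preserves residues and turns the gap condition
-- πᵢ − πᵢ₊₁ ≥ k into πᵢ ≥ πᵢ₊₁. Separability transfers along such a shift, with the shifted basis.

open import Defs
open import Algebra.Definitions using (Associative; LeftCancellative)
open import Data.Nat using (ℕ; zero; suc; _+_; _*_; _∸_; _≤_; _%_; _/_; NonZero; z≤n; s≤s; >-nonZero⁻¹)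
open import Data.Nat.Properties
open import Data.Nat.DivMod using (m≡m%n+[m/n]*n; m%n<n; m<n⇒m%n≡m; n%n≡0; %-remove-+ˡ; %-remove-+ʳ; /-monoˡ-≤)
open import Data.Nat.Divisibility using (_∣_; n∣m*n)
open import Data.List using (List; []; _∷_; length; zipWith; map; upTo; cartesianProductWith)
open import Data.List.Properties using (∷-injective; length-map; length-zipWith)
open import Data.List.Membership.Propositional using (_∈_)
open import Data.List.Membership.Propositional.Properties using (∈-map⁺; ∈-upTo⁺; ∈-cartesianProductWith⁺)
open import Data.List.Relation.Unary.Any using (here)
open import Data.Product using (∃; _×_; _,_; proj₁; proj₂)
open import Data.Sum using (inj₁; inj₂)
open import Data.Unit using (tt)
open import Relation.Binary.PropositionalEquality

module _ {Q S : ℕ → Set} where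

  Each-mono : (∀ {x} → Q x → S x) → ∀ {xs} → Each Q xs → Each S xs
  Each-mono f {[]}     _          = tt
  Each-mono f {_ ∷ _}  (qx , qxs) = f qx , Each-mono f qxs

  Each-map : ∀ {g : ℕ → ℕ} → (∀ {x} → Q x → S (g x)) → ∀ {xs} → Each Q xs → Each S (map g xs)
  Each-map f {[]}     _          = tt
  Each-map f {_ ∷ _}  (qx , qxs) = f qx , Each-map f qxs

  Each-map⁻ : ∀ {g : ℕ → ℕ} → (∀ {x} → S (g x) → Q x) → ∀ {xs} → Each S (map g xs) → Each Q xs
  Each-map⁻ f {[]}     _          = tt
  Each-map⁻ f {_ ∷ _}  (sx , sxs) = f sx , Each-map⁻ f sxs

module _ {R S : ℕ → ℕ → Set} where

  Consec-map : ∀ {g : ℕ → ℕ} → (∀ {x y} → R x y → S (g x) (g y)) →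
               ∀ {xs} → Consec R xs → Consec S (map g xs)
  Consec-map f {[]}         _          = tt
  Consec-map f {_ ∷ []}     _          = tt
  Consec-map f {_ ∷ _ ∷ _}  (rxy , rs) = f rxy , Consec-map f rs

  Consec-map⁻ : ∀ {g : ℕ → ℕ} → (∀ {x y} → S (g x) (g y) → R x y) →
                ∀ {xs} → Consec S (map g xs) → Consec R xs
  Consec-map⁻ f {[]}         _          = tt
  Consec-map⁻ f {_ ∷ []}     _          = tt
  Consec-map⁻ f {_ ∷ _ ∷ _}  (sxy , ss) = f sxy , Consec-map⁻ f ss

module _ {_∙_ : ℕ → ℕ → ℕ} where

  Each-zipWith : ∀ {Q Q′ S : ℕ → Set} → (∀ {x y} → Q x → Q′ y → S (x ∙ y)) →
                 ∀ {xs ys} → Each Q xs → Each Q′ ys → Each S (zipWith _∙_ xs ys)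
  Each-zipWith f {[]}     {_}      _          _          = tt
  Each-zipWith f {_ ∷ _}  {[]}     _          _          = tt
  Each-zipWith f {_ ∷ _}  {_ ∷ _}  (qx , qxs) (qy , qys) = f qx qy , Each-zipWith f qxs qys

  Consec-zipWith : ∀ {R R′ S : ℕ → ℕ → Set} → (∀ {x x′ y y′} → R x x′ → R′ y y′ → S (x ∙ y) (x′ ∙ y′)) →
                   ∀ {xs ys} → Consec R xs → Consec R′ ys → Consec S (zipWith _∙_ xs ys)
  Consec-zipWith f {[]}          {_}           _          _          = tt
  Consec-zipWith f {_ ∷ _}       {[]}          _          _          = tt
  Consec-zipWith f {_ ∷ []}      {_ ∷ _}       _          _          = tt
  Consec-zipWith f {_ ∷ _ ∷ _}   {_ ∷ []}      _          _          = tt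
  Consec-zipWith f {x ∷ x′ ∷ xs} {y ∷ y′ ∷ ys} (rx , rxs) (ry , rys) =
    f rx ry , Consec-zipWith f {x′ ∷ xs} {y′ ∷ ys} rxs rys

  zipWith-map-map : ∀ {f g : ℕ → ℕ} {xs} → Each (λ x → f x ∙ g x ≡ x) xs →
                    zipWith _∙_ (map f xs) (map g xs) ≡ xs
  zipWith-map-map {xs = []}     _          = refl
  zipWith-map-map {xs = x ∷ xs} (ex , exs) = cong₂ _∷_ ex (zipWith-map-map exs)

  length-zipWith-≡ : ∀ xs ys → length ys ≡ length xs → length (zipWith _∙_ xs ys) ≡ length xs
  length-zipWith-≡ xs ys eq = trans (length-zipWith _∙_ xs ys) (m≤n⇒m⊓n≡m (≤-reflexive (sym eq)))

  zipWith-assoc : Associative _≡_ _∙_ → ∀ xs ys zs →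
                  zipWith _∙_ xs (zipWith _∙_ ys zs) ≡ zipWith _∙_ (zipWith _∙_ xs ys) zs
  zipWith-assoc assoc []       _        _        = refl
  zipWith-assoc assoc (_ ∷ _)  []       _        = refl
  zipWith-assoc assoc (_ ∷ _)  (_ ∷ _)  []       = refl
  zipWith-assoc assoc (x ∷ xs) (y ∷ ys) (z ∷ zs) =
    cong₂ _∷_ (sym (assoc x y z)) (zipWith-assoc assoc xs ys zs)

  zipWith-cancelˡ : LeftCancellative _≡_ _∙_ → ∀ xs ys zs →
                    length ys ≡ length xs → length zs ≡ length xs →
                    zipWith _∙_ xs ys ≡ zipWith _∙_ xs zs → ys ≡ zs
  zipWith-cancelˡ cancel []       []       []       _  _  _  = refl
  zipWith-cancelˡ cancel (x ∷ xs) (y ∷ ys) (z ∷ zs) ly lz eq with ∷-injective eq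
  ... | hd , tl = cong₂ _∷_ (cancel x y z hd)
                    (zipWith-cancelˡ cancel xs ys zs (suc-injective ly) (suc-injective lz) tl)

listsOver : List ℕ → ℕ → List (List ℕ)
listsOver xs zero    = [] ∷ []
listsOver xs (suc m) = cartesianProductWith _∷_ xs (listsOver xs m)

∈-listsOver : ∀ {xs ys m} → Each (_∈ xs) ys → length ys ≡ m → ys ∈ listsOver xs m
∈-listsOver {ys = []}     _        refl = here refl
∈-listsOver {ys = y ∷ ys} (y∈ , e) refl = ∈-cartesianProductWith⁺ _∷_ y∈ (∈-listsOver e refl)

shift : (ℕ → List ℕ) → List ℕ → List ℕ
shift s π = zipWith _+_ (s (length π)) π

module _ {s : ℕ → List ℕ} (length-s : ∀ m → length (s m) ≡ m) where

  length-shift : ∀ π → length (shift s π) ≡ length π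
  length-shift π = trans (length-zipWith-≡ (s (length π)) π (sym (length-s (length π)))) (length-s (length π))

  shift-injective : ∀ {π π′} → shift s π ≡ shift s π′ → π ≡ π′
  shift-injective {π} {π′} eq =
    zipWith-cancelˡ +-cancelˡ-≡ (s (length π)) π π′ (sym (length-s _)) (trans lπ′ (sym (length-s _)))
      (trans eq (cong (λ m → zipWith _+_ (s m) π′) lπ′))
    where
    lπ′ : length π′ ≡ length π
    lπ′ = trans (sym (length-shift π′)) (trans (cong length (sym eq)) (length-shift π))

  shift-zipWith : ∀ b μ → length μ ≡ length b → shift s (zipWith _+_ b μ) ≡ zipWith _+_ (shift s b) μ
  shift-zipWith b μ eq = begin
    zipWith _+_ (s (length (zipWith _+_ b μ))) (zipWith _+_ b μ)
      ≡⟨ cong (λ m → zipWith _+_ (s m) (zipWith _+_ b μ)) (length-zipWith-≡ b μ eq) ⟩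
    zipWith _+_ (s (length b)) (zipWith _+_ b μ)
      ≡⟨ zipWith-assoc +-assoc (s (length b)) b μ ⟩
    zipWith _+_ (shift s b) μ ∎
    where open ≡-Reasoning

  module _ {k : ℕ} {P Q : PartitionSet} (sipc : IsSIPC k P)
           (Q⇒IsPartition : ∀ π → Q π → IsPartition π)
           (P⇒Q : ∀ π → P π → Q (shift s π))
           (Q⇒P : ∀ π → Q π → ∃ λ π′ → P π′ × π ≡ shift s π′) where

    open IsSIPC sipc

    shifted-basis : PartitionSet
    shifted-basis b = ∃ λ c → basis c × b ≡ shift s c

    shifted-basisFinite : ∀ m → 1 ≤ m → ∃ λ L → ∀ b → shifted-basis b → length b ≡ m → b ∈ L
    shifted-basisFinite m 1≤m with basisFinite m 1≤m
    ... | L , complete = map (shift s) L , λ { _ (c , bc , refl) lb →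
      ∈-map⁺ (shift s) (complete c bc (trans (sym (length-shift c)) lb)) }

    shifted-decomp : ∀ π → Q π → 1 ≤ length π → ∃ λ b → ∃ λ μ →
                     shifted-basis b × length b ≡ length π × length μ ≡ length π ×
                     IsKSeq k μ × π ≡ zipWith _+_ b μ
    shifted-decomp π qπ nonempty with Q⇒P π qπ
    ... | π′ , pπ′ , refl with decomp π′ pπ′ (subst (1 ≤_) (length-shift π′) nonempty)
    ... | c , μ , bc , lc , lμ , kμ , refl =
      shift s c , μ , (c , bc , refl) ,
      trans (length-shift c) (trans lc (sym (length-shift _))) , trans lμ (sym (length-shift _)) ,
      kμ , shift-zipWith c μ (trans lμ (sym lc))

    shifted-decompUnique : ∀ b b′ μ μ′ → shifted-basis b → shifted-basis b′ →
                           length μ ≡ length b → length b′ ≡ length b → length μ′ ≡ length b →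
                           IsKSeq k μ → IsKSeq k μ′ → zipWith _+_ b μ ≡ zipWith _+_ b′ μ′ →
                           b ≡ b′ × μ ≡ μ′
    shifted-decompUnique _ _ μ μ′ (c , bc , refl) (c′ , bc′ , refl) lμ lb′ lμ′ kμ kμ′ eq =
      let c≡c′ , μ≡μ′ = decompUnique c c′ μ μ′ bc bc′ lμᶜ lc′ lμ′ᶜ kμ kμ′ unshifted
      in cong (shift s) c≡c′ , μ≡μ′
      where
      lc′ : length c′ ≡ length c
      lc′ = trans (sym (length-shift c′)) (trans lb′ (length-shift c))
      lμᶜ : length μ ≡ length c
      lμᶜ = trans lμ (length-shift c)
      lμ′ᶜ : length μ′ ≡ length c
      lμ′ᶜ = trans lμ′ (length-shift c)
      unshifted : zipWith _+_ c μ ≡ zipWith _+_ c′ μ′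
      unshifted = shift-injective (begin
        shift s (zipWith _+_ c μ)     ≡⟨ shift-zipWith c μ lμᶜ ⟩
        zipWith _+_ (shift s c) μ     ≡⟨ eq ⟩
        zipWith _+_ (shift s c′) μ′   ≡⟨ shift-zipWith c′ μ′ (trans lμ′ᶜ (sym lc′)) ⟨
        shift s (zipWith _+_ c′ μ′)   ∎)
        where open ≡-Reasoning

    shifted-closed : ∀ b μ → shifted-basis b → 1 ≤ length b → length μ ≡ length b → IsKSeq k μ →
                     Q (zipWith _+_ b μ)
    shifted-closed _ μ (c , bc , refl) nonempty lμ kμ =
      subst Q (shift-zipWith c μ lμᶜ) (P⇒Q _ (closed c μ bc (subst (1 ≤_) (length-shift c) nonempty) lμᶜ kμ))
      where
      lμᶜ : length μ ≡ length c
      lμᶜ = trans lμ (length-shift c)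

    shift-IsSIPC : IsSIPC k Q
    shift-IsSIPC = record
      { allPartitions = Q⇒IsPartition
      ; basis         = shifted-basis
      ; basis⊆        = λ { _ (c , bc , refl) → P⇒Q c (basis⊆ c bc) }
      ; basisFinite   = shifted-basisFinite
      ; decomp        = shifted-decomp
      ; decompUnique  = shifted-decompUnique
      ; closed        = shifted-closed
      }

BoundedPartition : ℕ → PartitionSet
BoundedPartition r b = Each (λ c → 1 ≤ c × c ≤ r) b × Consec (λ x y → y ≤ x) b

BoundedPartition⇒IsPartition : ∀ {r b} → BoundedPartition r b → IsPartition b
BoundedPartition⇒IsPartition (bounded , nonincreasing) = Each-mono proj₁ bounded , nonincreasing

BoundedPartition-enumerable : ∀ r m → ∃ λ L → ∀ b → BoundedPartition r b → length b ≡ m → b ∈ L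
BoundedPartition-enumerable r m = listsOver (upTo (suc r)) m , λ _ (bounded , _) →
  ∈-listsOver (Each-mono (λ (_ , c≤r) → ∈-upTo⁺ (s≤s c≤r)) bounded)

IsPartition-zipWith : ∀ {k b μ} → IsPartition b → IsKSeq k μ → IsPartition (zipWith _+_ b μ)
IsPartition-zipWith (positive , nonincreasing) (k∣μ , μ-nonincreasing) =
  Each-zipWith (λ 1≤x _ → ≤-trans 1≤x (m≤m+n _ _)) positive k∣μ ,
  Consec-zipWith +-mono-≤ nonincreasing μ-nonincreasing

module _ (k : ℕ) .{{_ : NonZero k}} where

  private
    representative : ℕ → ℕ
    representative zero    = k
    representative (suc j) = suc j

    representative-positive : ∀ j → 1 ≤ representative j
    representative-positive zero    = >-nonZero⁻¹ k
    representative-positive (suc _) = s≤s z≤n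

    representative-fixed : ∀ {j} → 1 ≤ j → representative j ≡ j
    representative-fixed (s≤s _) = refl

    φ≡representative : ∀ x → φ k x ≡ representative (x % k)
    φ≡representative x with x % k
    ... | zero  = refl
    ... | suc j = refl

  φ-cong : ∀ {x y} → x % k ≡ y % k → φ k x ≡ φ k y
  φ-cong {x} {y} eq = begin
    φ k x                    ≡⟨ φ≡representative x ⟩
    representative (x % k)   ≡⟨ cong representative eq ⟩
    representative (y % k)   ≡⟨ φ≡representative y ⟨
    φ k y                    ∎
    where open ≡-Reasoning

  φ-positive : ∀ x → 1 ≤ φ k x
  φ-positive x = subst (1 ≤_) (sym (φ≡representative x)) (representative-positive (x % k))

  φ-fixed : ∀ {c} → 1 ≤ c → c ≤ k → φ k c ≡ c
  φ-fixed {c} 1≤c c≤k with m≤n⇒m<n∨m≡n c≤k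
  ... | inj₂ refl = trans (φ≡representative c) (cong representative (n%n≡0 c))
  ... | inj₁ c<k  =
    trans (φ≡representative c) (trans (cong representative (m<n⇒m%n≡m c<k)) (representative-fixed 1≤c))

  φ-canonical : ∀ {c a} → 1 ≤ c → c ≤ k → k ∣ a → φ k (c + a) ≡ c
  φ-canonical {c} 1≤c c≤k k∣a = trans (φ-cong (%-remove-+ʳ c k∣a)) (φ-fixed 1≤c c≤k)

  φ-+-multiple : ∀ {a} x → k ∣ a → φ k (a + x) ≡ φ k x
  φ-+-multiple x k∣a = φ-cong (%-remove-+ˡ x k∣a)

  quotient : ℕ → ℕ
  quotient x = (x ∸ 1) / k

  quotient-mono : ∀ {x y} → y ≤ x → quotient y ≤ quotient x
  quotient-mono y≤x = /-monoˡ-≤ k (∸-monoˡ-≤ 1 y≤x)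

  φ+quotient : ∀ {x} → 1 ≤ x → φ k x + quotient x * k ≡ x
  φ+quotient {suc y} _ = begin
    φ k (suc y) + (y / k) * k             ≡⟨ cong (_+ (y / k) * k) φ-suc ⟩
    suc (y % k) + (y / k) * k             ≡⟨ cong suc (m≡m%n+[m/n]*n y k) ⟨
    suc y                                 ∎
    where
    open ≡-Reasoning
    φ-suc : φ k (suc y) ≡ suc (y % k)
    φ-suc = trans (cong (φ k) (cong suc (m≡m%n+[m/n]*n y k)))
                  (φ-canonical (s≤s z≤n) (m%n<n y k) (n∣m*n (y / k)))

  Pkr⇒BoundedPartition-φ : ∀ {r π} → Pkr k r π → BoundedPartition r (map (φ k) π)
  Pkr⇒BoundedPartition-φ (_ , φ≤r , φ-nonincreasing) =
    Each-map (λ {x} φx≤r → φ-positive x , φx≤r) φ≤r , Consec-map (λ h → h) φ-nonincreasing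

  BoundedPartition-φ⇒Pkr : ∀ {r π} → IsPartition π → BoundedPartition r (map (φ k) π) → Pkr k r π
  BoundedPartition-φ⇒Pkr partition (bounded , nonincreasing) =
    partition , Each-map⁻ proj₂ bounded , Consec-map⁻ (λ h → h) nonincreasing

  Pkr-decomp : ∀ {r} π → Pkr k r π → 1 ≤ length π → ∃ λ b → ∃ λ μ →
               BoundedPartition r b × length b ≡ length π × length μ ≡ length π ×
               IsKSeq k μ × π ≡ zipWith _+_ b μ
  Pkr-decomp π pπ@((positive , nonincreasing) , _) _ =
    map (φ k) π , map (λ x → quotient x * k) π , Pkr⇒BoundedPartition-φ pπ ,
    length-map _ π , length-map _ π ,
    (Each-map (λ {x} _ → n∣m*n (quotient x)) positive ,
     Consec-map (λ y≤x → *-monoˡ-≤ k (quotient-mono y≤x)) nonincreasing) ,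
    sym (zipWith-map-map (Each-mono φ+quotient positive))

  module _ {r : ℕ} (r≤k : r ≤ k) where

    map-φ-fixed : ∀ {b} → Each (λ c → 1 ≤ c × c ≤ r) b → map (φ k) b ≡ b
    map-φ-fixed {[]}    _                       = refl
    map-φ-fixed {c ∷ b} ((1≤c , c≤r) , bounded) =
      cong₂ _∷_ (φ-fixed 1≤c (≤-trans c≤r r≤k)) (map-φ-fixed bounded)

    map-φ-zipWith : ∀ b μ → Each (λ c → 1 ≤ c × c ≤ r) b → Each (k ∣_) μ → length μ ≡ length b →
                    map (φ k) (zipWith _+_ b μ) ≡ b
    map-φ-zipWith []      []      _                       _            _  = refl
    map-φ-zipWith (c ∷ b) (a ∷ μ) ((1≤c , c≤r) , bounded) (k∣a , k∣μ) lμ =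
      cong₂ _∷_ (φ-canonical 1≤c (≤-trans c≤r r≤k) k∣a) (map-φ-zipWith b μ bounded k∣μ (suc-injective lμ))

    BoundedPartition⇒Pkr : ∀ b → BoundedPartition r b → Pkr k r b
    BoundedPartition⇒Pkr b bb@(bounded , _) =
      BoundedPartition-φ⇒Pkr (BoundedPartition⇒IsPartition bb)
        (subst (BoundedPartition r) (sym (map-φ-fixed bounded)) bb)

    Pkr-decompUnique : ∀ b b′ μ μ′ → BoundedPartition r b → BoundedPartition r b′ →
                       length μ ≡ length b → length b′ ≡ length b → length μ′ ≡ length b →
                       IsKSeq k μ → IsKSeq k μ′ → zipWith _+_ b μ ≡ zipWith _+_ b′ μ′ → b ≡ b′ × μ ≡ μ′
    Pkr-decompUnique b b′ μ μ′ (bounded , _) (bounded′ , _) lμ lb′ lμ′ (k∣μ , _) (k∣μ′ , _) eq = b≡b′ , μ≡μ′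
      where
      b≡b′ : b ≡ b′
      b≡b′ = begin
        b                                ≡⟨ map-φ-zipWith b μ bounded k∣μ lμ ⟨
        map (φ k) (zipWith _+_ b μ)      ≡⟨ cong (map (φ k)) eq ⟩
        map (φ k) (zipWith _+_ b′ μ′)    ≡⟨ map-φ-zipWith b′ μ′ bounded′ k∣μ′ (trans lμ′ (sym lb′)) ⟩
        b′                               ∎
        where open ≡-Reasoning
      μ≡μ′ : μ ≡ μ′
      μ≡μ′ = zipWith-cancelˡ +-cancelˡ-≡ b μ μ′ lμ lμ′ (trans eq (cong (λ c → zipWith _+_ c μ′) (sym b≡b′)))

    Pkr-closed : ∀ b μ → BoundedPartition r b → 1 ≤ length b → length μ ≡ length b → IsKSeq k μ →
                 Pkr k r (zipWith _+_ b μ)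
    Pkr-closed b μ bb@(bounded , _) _ lμ kμ@(k∣μ , _) =
      BoundedPartition-φ⇒Pkr (IsPartition-zipWith (BoundedPartition⇒IsPartition bb) kμ)
        (subst (BoundedPartition r) (sym (map-φ-zipWith b μ bounded k∣μ lμ)) bb)

    Pkr-IsSIPC : IsSIPC k (Pkr k r)
    Pkr-IsSIPC = record
      { allPartitions = λ _ → proj₁
      ; basis         = BoundedPartition r
      ; basis⊆        = BoundedPartition⇒Pkr
      ; basisFinite   = λ m _ → BoundedPartition-enumerable r m
      ; decomp        = Pkr-decomp
      ; decompUnique  = Pkr-decompUnique
      ; closed        = Pkr-closed
      }

  staircase : ℕ → List ℕ
  staircase zero    = []
  staircase (suc m) = m * k ∷ staircase m

  length-staircase : ∀ m → length (staircase m) ≡ m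
  length-staircase zero    = refl
  length-staircase (suc m) = cong suc (length-staircase m)

  m*k+n+k≡[1+m]*k+n : ∀ m n → m * k + n + k ≡ suc m * k + n
  m*k+n+k≡[1+m]*k+n m n = trans (+-comm (m * k + n) k) (sym (+-assoc k (m * k) n))

  peel-stair : ∀ ℓ {x y} → ℓ * k + y + k ≤ x → ∃ λ x′ → y ≤ x′ × suc ℓ * k + x′ ≡ x
  peel-stair ℓ {x} {y} gap =
    let x′ , eq = m≤n⇒∃[o]m+o≡n (≤-trans (m≤m+n (suc ℓ * k) y) gap′)
    in x′ , +-cancelˡ-≤ (suc ℓ * k) y x′ (subst (suc ℓ * k + y ≤_) (sym eq) gap′) , eq
    where
    gap′ : suc ℓ * k + y ≤ x
    gap′ = subst (_≤ x) (m*k+n+k≡[1+m]*k+n ℓ y) gap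

  Pkr-∷ : ∀ {r x y ys} → 1 ≤ x → y ≤ x → φ k x ≤ r → φ k y ≤ φ k x →
          Pkr k r (y ∷ ys) → Pkr k r (x ∷ y ∷ ys)
  Pkr-∷ 1≤x y≤x φx≤r φy≤φx ((positive , nonincreasing) , φ≤r , φ-nonincreasing) =
    ((1≤x , positive) , (y≤x , nonincreasing)) , (φx≤r , φ≤r) , (φy≤φx , φ-nonincreasing)

  Dkr-∷ : ∀ {r x y ys} → 1 ≤ x → φ k x ≤ r → φ k y ≤ φ k x → y + k ≤ x →
          Dkr k r (y ∷ ys) → Dkr k r (x ∷ y ∷ ys)
  Dkr-∷ {y = y} 1≤x φx≤r φy≤φx y+k≤x (p , gaps) =
    Pkr-∷ 1≤x (≤-trans (m≤m+n y k) y+k≤x) φx≤r φy≤φx p , (y+k≤x , gaps)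

  Pkr⇒Dkr-shift : ∀ {r} π → Pkr k r π → Dkr k r (shift staircase π)
  Pkr⇒Dkr-shift []       p = p , tt
  Pkr⇒Dkr-shift (x ∷ []) p = p , tt
  Pkr⇒Dkr-shift {r} (x ∷ y ∷ ys)
    (((1≤x , positive) , (y≤x , nonincreasing)) , (φx≤r , φ≤r) , (φy≤φx , φ-nonincreasing)) =
    Dkr-∷ (≤-trans 1≤x (m≤n+m x _)) (subst (_≤ r) (sym φx-shifted) φx≤r)
          (subst₂ _≤_ (sym φy-shifted) (sym φx-shifted) φy≤φx) gap
          (Pkr⇒Dkr-shift (y ∷ ys) ((positive , nonincreasing) , φ≤r , φ-nonincreasing))
    where
    ℓ : ℕ
    ℓ = length ys
    φx-shifted : φ k (suc ℓ * k + x) ≡ φ k x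
    φx-shifted = φ-+-multiple x (n∣m*n (suc ℓ))
    φy-shifted : φ k (ℓ * k + y) ≡ φ k y
    φy-shifted = φ-+-multiple y (n∣m*n ℓ)
    gap : ℓ * k + y + k ≤ suc ℓ * k + x
    gap = subst (_≤ suc ℓ * k + x) (sym (m*k+n+k≡[1+m]*k+n ℓ y)) (+-monoʳ-≤ (suc ℓ * k) y≤x)

  Dkr⇒shift-Pkr : ∀ {r} π → Dkr k r π → ∃ λ π′ → Pkr k r π′ × π ≡ shift staircase π′
  Dkr⇒shift-Pkr []       (p , _) = [] , p , refl
  Dkr⇒shift-Pkr (x ∷ []) (p , _) = x ∷ [] , p , refl
  Dkr⇒shift-Pkr {r} (x ∷ y ∷ ys)
    ((((_ , positive) , (_ , nonincreasing)) , (φx≤r , φ≤r) , (φy≤φx , φ-nonincreasing)) , (y+k≤x , gaps))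
    with Dkr⇒shift-Pkr (y ∷ ys) (((positive , nonincreasing) , φ≤r , φ-nonincreasing) , gaps)
  ... | [] , _ , ()
  ... | y′ ∷ ys′ , p′@(((1≤y′ , _) , _) , _) , refl with peel-stair (length ys′) y+k≤x
  ... | x′ , y′≤x′ , refl = x′ ∷ y′ ∷ ys′ , Pkr-∷ (≤-trans 1≤y′ y′≤x′) y′≤x′ φx′≤r φy′≤φx′ p′ , refl
    where
    ℓ : ℕ
    ℓ = length ys′
    φx-shifted : φ k (suc ℓ * k + x′) ≡ φ k x′
    φx-shifted = φ-+-multiple x′ (n∣m*n (suc ℓ))
    φx′≤r : φ k x′ ≤ r
    φx′≤r = subst (_≤ r) φx-shifted φx≤r
    φy′≤φx′ : φ k y′ ≤ φ k x′
    φy′≤φx′ = subst₂ _≤_ (φ-+-multiple y′ (n∣m*n ℓ)) φx-shifted φy≤φx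

  Dkr-IsSIPC : ∀ {r} → r ≤ k → IsSIPC k (Dkr k r)
  Dkr-IsSIPC r≤k = shift-IsSIPC {s = staircase} length-staircase (Pkr-IsSIPC r≤k)
    (λ _ d → proj₁ (proj₁ d)) Pkr⇒Dkr-shift Dkr⇒shift-Pkr

mainTheorem7 : ∀ (k r : ℕ) .{{_ : NonZero k}} → 1 ≤ r → r ≤ k →
    IsSIPC k (Pkr k r) × IsSIPC k (Dkr k r)
mainTheorem7 k r _ r≤k = Pkr-IsSIPC k r≤k , Dkr-IsSIPC k r≤k
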